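{- Let $a,b$ be coprime positive integers and let $\Phi$ be the fixed point beginning with $0$ of the morphism $0\mapsto00101$, $1\mapsto11011$. Let $C=\left\lceil\max\left\{1+\frac{a+2b}{3},\,b,\,\frac{b-a}{3},\,4\right\}\right\rceil$ and \[M_{a,b}=\max\left\{(a+2b)\max\{a,b\},\ \frac{a+2b}{3}\left(132\cdot5^{C-4}+|a-b|\right)\right\}.\] Then every integer $M\ge M_{a,b}$ can be written as $M=ax+by$ with $x,y$ non-negative integers, and there is an integer $t$ such that $M=a(x-tb)+b(y+ta)$ with $(x-tb,\,y+ta)\in\psi(\mathcal{L}_\Phi)$.
   Context: $\mathcal{L}_\Phi$ is the set of factors of $\Phi$; for a binary word $u$, $\psi(u)=(|u|_0,|u|_1)$ is its Parikh vector, and $\psi(\mathcal{L}_\Phi)=\{\psi(u):u\in\mathcal{L}_\Phi\}$. -}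

module Defs where

open import Data.Bool using (Bool; true; false)
open import Data.Nat using (ℕ; zero; suc; _+_; _*_; _∸_; _^_; _⊔_; _/_; ∣_-_∣)
open import Data.List using (List; []; _∷_; _++_; concatMap; length; filter; map; upTo)
open import Data.Product using (_×_; _,_; ∃; ∃-syntax)
open import Data.Maybe using (Maybe; just; nothing; fromMaybe)
open import Relation.Binary.PropositionalEquality using (_≡_)

-- Letters: false = 0, true = 1.
Word : Set
Word = List Bool

σ₁ : Bool → Word
σ₁ false = false ∷ false ∷ true ∷ false ∷ true ∷ []
σ₁ true  = true ∷ true ∷ false ∷ true ∷ true ∷ []

σ : Word → Word
σ = concatMap σ₁

σ^ : ℕ → Word
σ^ zero    = false ∷ []
σ^ (suc n) = σ (σ^ n)

nth : Word → ℕ → Maybe Bool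
nth []       _       = nothing
nth (x ∷ xs) zero    = just x
nth (x ∷ xs) (suc k) = nth xs k

-- The fixed point Φ = lim σ^n(0) (beginning with 0), as an infinite word ℕ → letter.
-- |σ^(k+1)(0)| = 5^(k+1) > k, so the default value is never used.
Φ : ℕ → Bool
Φ k = fromMaybe false (nth (σ^ (suc k)) k)

slice : ℕ → ℕ → Word
slice i zero    = []
slice i (suc n) = Φ i ∷ slice (suc i) n

InL : Word → Set
InL u = ∃[ i ] u ≡ slice i (length u)

count : Bool → Word → ℕ
count b []       = 0
count b (x ∷ xs) with b | x
... | false | false = suc (count b xs)
... | true  | true  = suc (count b xs)
... | _     | _     = count b xs

ψ : Word → ℕ × ℕ
ψ u = count false u , count true u

InψL : ℕ × ℕ → Set
InψL v = ∃[ u ] (InL u × ψ u ≡ v)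

-- C = ⌈max{1 + (a+2b)/3, b, (b-a)/3, 4}⌉ = ⌈max{3+a+2b, 3b, b-a, 12}/3⌉
-- (b ∸ a only matters when b > a, since the max with 12 dominates otherwise).
Cab : ℕ → ℕ → ℕ
Cab a b = (((3 + a + 2 * b) ⊔ (3 * b) ⊔ (b ∸ a) ⊔ 12) + 2) / 3

-- 3 · (the second term inside M_{a,b}) = (a+2b)(132·5^(C-4) + |a-b|)
B3 : ℕ → ℕ → ℕ
B3 a b = (a + 2 * b) * (132 * 5 ^ (Cab a b ∸ 4) + ∣ a - b ∣)

-- M ≥ M_{a,b}  ⇔  M ≥ (a+2b)·max{a,b}  and  3M ≥ (a+2b)(132·5^(C-4)+|a-b|)

module Submission where

-- Measure words by the discrepancy D w = 2|w|₀ - |w|₁, so that 3|w|₀ = |w| + D w, and view a word as a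
-- walk that moves +2 on a 0 and -1 on a 1.
--  * Φ is the fixed point of σ, so the factor of length 5^k·m at position 5^k·j is σ^k of the factor of
--    length m at j (slice-σⁿ).
--  * Walks are self-similar: if the walk of w stays in [lo, hi], then the walk of σ^k w started at 2^k
--    times the start stays in [2^k·lo, 2^k·hi + 2^k - 1] (within-σⁿ).  Applied to Φ[0..4] = 00101 and
--    Φ[48..52] = 11110, a window of length n ∈ [5^k, 5^(k+1)] has D ≥ 2^(k+1) at position 0 and D ≤ -1 at
--    position 48·5^k (near-window, far-window).
--  * Sliding a window by one position changes its number of zeros by at most one, so a discrete
--    intermediate value argument realises every zero count p with 3p + 1 = n + e, 0 ≤ e ≤ 2^(k+1)
--    (zeros-in-window).
--  * Bézout and division by N = a + 2b give integers p, q with ap + bq = M and 2p - q + 1 = e ∈ [0, N)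
--    (balanced-solution).  The identity N(p+q) + (a-b)(2p-q) = 3(ap+bq) and the hypothesis on M force
--    p + q ≥ 132·5^j for j = C - 4 (long-solution), while N ≤ 16·2^j (base-small); a factor of length
--    p + q with p zeros then has weight exactly M (weight-of-factor).

open import Defs
open import Data.Bool using (Bool; true; false)
open import Data.Nat as ℕ using (ℕ; zero; suc; _+_; _*_; _∸_; _^_; _≤_; _<_; _⊔_; _/_; _%_; z≤n; s≤s; s≤s⁻¹; z<s; s<s; _≤?_; _<?_; ∣_-_∣; NonZero)
import Data.Nat.Properties as ℕP
open import Data.Nat.DivMod using (m≡m%n+[m/n]*n; m%n<n)
open import Data.Nat.Coprimality using (Coprime; coprime-Bézout)
open import Data.Nat.GCD using (module Bézout)
open import Data.Nat.Tactic.RingSolver using (solve-∀)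
open import Data.List using ([]; _∷_; _++_; length)
open import Data.List.Properties using (length-++; concatMap-++)
open import Data.Maybe using (just; fromMaybe)
open import Data.Product using (_×_; _,_; ∃; ∃-syntax; proj₁; proj₂; map₂)
open import Data.Sum using (inj₁; inj₂)
open import Data.Empty using (⊥-elim)
open import Relation.Nullary using (Dec; yes; no)
open import Relation.Nullary.Decidable using (_×-dec_; from-yes)
open import Relation.Binary.PropositionalEquality
open import Data.Integer using (ℤ; +_; -_; +≤+; +<+; ∣_∣; positive) renaming (_+_ to _+ᶻ_; _*_ to _*ᶻ_; _-_ to _-ᶻ_; _≤_ to _≤ᶻ_; _≤?_ to _≤ᶻ?_)
open import Data.Integer.DivMod using (_/ℕ_; _%ℕ_; a≡a%ℕn+[a/ℕn]*n; n%ℕd<d)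
import Data.Integer.Properties as ℤP
import Data.Integer.Tactic.RingSolver as ℤSolver
open import Function using (case_of_)

σ-++ : ∀ u v → σ (u ++ v) ≡ σ u ++ σ v
σ-++ = concatMap-++ σ₁

-- σⁿ k w = σ^k(w); unfolding σ on the inside makes σⁿ (suc k) w = σⁿ k (σ w) definitional.
σⁿ : ℕ → Word → Word
σⁿ zero    w = w
σⁿ (suc k) w = σⁿ k (σ w)

length-σ₁ : ∀ x → length (σ₁ x) ≡ 5
length-σ₁ false = refl
length-σ₁ true  = refl

length-σ : ∀ w → length (σ w) ≡ 5 * length w
length-σ []      = refl
length-σ (x ∷ w) = begin
  length (σ₁ x ++ σ w)        ≡⟨ length-++ (σ₁ x) ⟩
  length (σ₁ x) + length (σ w) ≡⟨ cong₂ _+_ (length-σ₁ x) (length-σ w) ⟩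
  5 + 5 * length w            ≡⟨ ℕP.*-suc 5 (length w) ⟨
  5 * suc (length w)          ∎
  where open ≡-Reasoning

length-σ^ : ∀ m → length (σ^ m) ≡ 5 ^ m
length-σ^ zero    = refl
length-σ^ (suc m) = trans (length-σ (σ^ m)) (cong (5 *_) (length-σ^ m))

5^-mono : ∀ d m → 5 ^ m ≤ 5 ^ (d + m)
5^-mono d m = ℕP.^-monoʳ-≤ 5 (ℕP.m≤n+m m d)

n<5^n : ∀ n → n < 5 ^ n
n<5^n zero    = z<s
n<5^n (suc n) = ℕP.+-mono-≤ (ℕP.m^n>0 5 n) (ℕP.≤-trans (n<5^n n) (ℕP.m≤m+n (5 ^ n) (3 * 5 ^ n)))

n<5^[1+n] : ∀ n → n < 5 ^ suc n
n<5^[1+n] n = ℕP.<-≤-trans (n<5^n n) (5^-mono 1 n)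

nth-++ˡ : ∀ u v {i} → i < length u → nth (u ++ v) i ≡ nth u i
nth-++ˡ (x ∷ u) v {zero}  _         = refl
nth-++ˡ (x ∷ u) v {suc i} (s<s i<u) = nth-++ˡ u v i<u

nth-++ʳ : ∀ u v i → nth (u ++ v) (length u + i) ≡ nth v i
nth-++ʳ []      v i = refl
nth-++ʳ (x ∷ u) v i = nth-++ʳ u v i

nth-defined : ∀ w {i} → i < length w → ∃[ x ] nth w i ≡ just x
nth-defined (x ∷ w) {zero}  _         = x , refl
nth-defined (x ∷ w) {suc i} (s<s i<w) = nth-defined w i<w

σ^-extends : ∀ m → ∃[ r ] σ^ (suc m) ≡ σ^ m ++ r
σ^-extends zero    = _ , refl
σ^-extends (suc m) with σ^-extends m
... | r , eq = σ r , trans (cong σ eq) (σ-++ (σ^ m) r)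

nth-σ^-stable : ∀ d m {i} → i < 5 ^ m → nth (σ^ (d + m)) i ≡ nth (σ^ m) i
nth-σ^-stable zero    m i<5^m = refl
nth-σ^-stable (suc d) m {i} i<5^m with σ^-extends (d + m)
... | r , eq = begin
  nth (σ^ (suc (d + m))) i   ≡⟨ cong (λ w → nth w i) eq ⟩
  nth (σ^ (d + m) ++ r) i    ≡⟨ nth-++ˡ (σ^ (d + m)) r i<len ⟩
  nth (σ^ (d + m)) i         ≡⟨ nth-σ^-stable d m i<5^m ⟩
  nth (σ^ m) i               ∎
  where
  open ≡-Reasoning
  i<len : i < length (σ^ (d + m))
  i<len = subst (i <_) (sym (length-σ^ (d + m))) (ℕP.<-≤-trans i<5^m (5^-mono d m))

Φ-nth : ∀ m i → i < 5 ^ m → nth (σ^ m) i ≡ just (Φ i)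
Φ-nth m i i<5^m with nth-defined (σ^ m) (subst (i <_) (sym (length-σ^ m)) i<5^m)
... | x , nth≡x = trans nth≡x (cong (λ y → just (fromMaybe false y)) (sym nth-σ^[1+i]))
  where
  nth-σ^[1+i] : nth (σ^ (suc i)) i ≡ just x
  nth-σ^[1+i] = begin
    nth (σ^ (suc i)) i       ≡⟨ nth-σ^-stable m (suc i) (n<5^[1+n] i) ⟨
    nth (σ^ (m + suc i)) i   ≡⟨ cong (λ n → nth (σ^ n) i) (ℕP.+-comm m (suc i)) ⟩
    nth (σ^ (suc i + m)) i   ≡⟨ nth-σ^-stable (suc i) m i<5^m ⟩
    nth (σ^ m) i             ≡⟨ nth≡x ⟩
    just x                   ∎
    where open ≡-Reasoning

nth-σ : ∀ w j {r x} → r < 5 → nth w j ≡ just x → nth (σ w) (r + 5 * j) ≡ nth (σ₁ x) r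
nth-σ (y ∷ w) zero    {r} r<5 refl =
  trans (cong (nth (σ₁ y ++ σ w)) (ℕP.+-identityʳ r))
        (nth-++ˡ (σ₁ y) (σ w) (subst (r <_) (sym (length-σ₁ y)) r<5))
nth-σ (y ∷ w) (suc j) {r} {x} r<5 nth≡x = begin
  nth (σ₁ y ++ σ w) (r + 5 * suc j)                 ≡⟨ cong (nth (σ₁ y ++ σ w)) (shift r j) ⟩
  nth (σ₁ y ++ σ w) (length (σ₁ y) + (r + 5 * j))  ≡⟨ nth-++ʳ (σ₁ y) (σ w) (r + 5 * j) ⟩
  nth (σ w) (r + 5 * j)                             ≡⟨ nth-σ w j r<5 nth≡x ⟩
  nth (σ₁ x) r                                      ∎
  where
  open ≡-Reasoning
  next-block : ∀ r j → r + 5 * suc j ≡ 5 + (r + 5 * j)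
  next-block = solve-∀
  shift : ∀ r j → r + 5 * suc j ≡ length (σ₁ y) + (r + 5 * j)
  shift r j = trans (next-block r j) (cong (_+ (r + 5 * j)) (sym (length-σ₁ y)))

Φ-σ : ∀ j r → r < 5 → just (Φ (r + 5 * j)) ≡ nth (σ₁ (Φ j)) r
Φ-σ j r r<5 = trans (sym (Φ-nth (2 + j) (r + 5 * j) position-in-range))
                    (nth-σ (σ^ (suc j)) j r<5 (Φ-nth (suc j) j (n<5^[1+n] j)))
  where
  position-in-range : r + 5 * j < 5 * 5 ^ suc j
  position-in-range = ℕP.<-≤-trans (ℕP.+-monoˡ-< (5 * j) r<5)
                       (ℕP.≤-trans (ℕP.≤-reflexive (sym (ℕP.*-suc 5 j))) (ℕP.*-monoʳ-≤ 5 (n<5^[1+n] j)))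

slice-σ₁ : ∀ j → slice (5 * j) 5 ≡ σ₁ (Φ j)
slice-σ₁ j = same-letters (Φ j) (Φ-σ j 0 z<s) (Φ-σ j 1 (s<s z<s)) (Φ-σ j 2 (s<s (s<s z<s)))
               (Φ-σ j 3 (s<s (s<s (s<s z<s)))) (Φ-σ j 4 (s<s (s<s (s<s (s<s z<s)))))
  where
  same-letters : ∀ y {a₀ a₁ a₂ a₃ a₄} →
                 just a₀ ≡ nth (σ₁ y) 0 → just a₁ ≡ nth (σ₁ y) 1 → just a₂ ≡ nth (σ₁ y) 2 →
                 just a₃ ≡ nth (σ₁ y) 3 → just a₄ ≡ nth (σ₁ y) 4 →
                 a₀ ∷ a₁ ∷ a₂ ∷ a₃ ∷ a₄ ∷ [] ≡ σ₁ y
  same-letters false refl refl refl refl refl = refl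
  same-letters true  refl refl refl refl refl = refl

slice-++ : ∀ i m n → slice i (m + n) ≡ slice i m ++ slice (m + i) n
slice-++ i zero    n = refl
slice-++ i (suc m) n = cong (Φ i ∷_) (trans (slice-++ (suc i) m n) (cong (λ k → slice (suc i) m ++ slice k n) (ℕP.+-suc m i)))

length-slice : ∀ i n → length (slice i n) ≡ n
length-slice i zero    = refl
length-slice i (suc n) = cong suc (length-slice (suc i) n)

slice-σ : ∀ j m → slice (5 * j) (5 * m) ≡ σ (slice j m)
slice-σ j zero    = cong (slice (5 * j)) (ℕP.*-zeroʳ 5)
slice-σ j (suc m) = begin
  slice (5 * j) (5 * suc m)                          ≡⟨ cong (slice (5 * j)) (ℕP.*-suc 5 m) ⟩
  slice (5 * j) (5 + 5 * m)                          ≡⟨ slice-++ (5 * j) 5 (5 * m) ⟩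
  slice (5 * j) 5 ++ slice (5 + 5 * j) (5 * m)       ≡⟨ cong₂ _++_ (slice-σ₁ j) (cong (λ i → slice i (5 * m)) (sym (ℕP.*-suc 5 j))) ⟩
  σ₁ (Φ j) ++ slice (5 * suc j) (5 * m)              ≡⟨ cong (σ₁ (Φ j) ++_) (slice-σ (suc j) m) ⟩
  σ (slice j (suc m))                                ∎
  where open ≡-Reasoning

slice-σⁿ : ∀ k j m → slice (5 ^ k * j) (5 ^ k * m) ≡ σⁿ k (slice j m)
slice-σⁿ zero    j m = cong₂ slice (ℕP.*-identityˡ j) (ℕP.*-identityˡ m)
slice-σⁿ (suc k) j m = begin
  slice (5 * 5 ^ k * j) (5 * 5 ^ k * m)        ≡⟨ cong₂ slice (regroup j) (regroup m) ⟩
  slice (5 ^ k * (5 * j)) (5 ^ k * (5 * m))    ≡⟨ slice-σⁿ k (5 * j) (5 * m) ⟩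
  σⁿ k (slice (5 * j) (5 * m))                 ≡⟨ cong (σⁿ k) (slice-σ j m) ⟩
  σⁿ k (σ (slice j m))                         ∎
  where
  open ≡-Reasoning
  regroup : ∀ x → 5 * 5 ^ k * x ≡ 5 ^ k * (5 * x)
  regroup x = trans (cong (_* x) (ℕP.*-comm 5 (5 ^ k))) (ℕP.*-assoc (5 ^ k) 5 x)

d : Bool → ℤ
d false = + 2
d true  = - + 1

D : Word → ℤ
D []      = + 0
D (x ∷ w) = d x +ᶻ D w

D-++ : ∀ u v → D (u ++ v) ≡ D u +ᶻ D v
D-++ []      v = sym (ℤP.+-identityˡ (D v))
D-++ (x ∷ u) v = trans (cong (d x +ᶻ_) (D-++ u v)) (sym (ℤP.+-assoc (d x) (D u) (D v)))

D-σ₁ : ∀ x → D (σ₁ x) ≡ + 2 *ᶻ d x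
D-σ₁ false = refl
D-σ₁ true  = refl

D-σ : ∀ w → D (σ w) ≡ + 2 *ᶻ D w
D-σ []      = refl
D-σ (x ∷ w) = begin
  D (σ₁ x ++ σ w)                  ≡⟨ D-++ (σ₁ x) (σ w) ⟩
  D (σ₁ x) +ᶻ D (σ w)              ≡⟨ cong₂ _+ᶻ_ (D-σ₁ x) (D-σ w) ⟩
  + 2 *ᶻ d x +ᶻ + 2 *ᶻ D w         ≡⟨ ℤP.*-distribˡ-+ (+ 2) (d x) (D w) ⟨
  + 2 *ᶻ (d x +ᶻ D w)              ∎
  where open ≡-Reasoning

pow2 : ℕ → ℤ
pow2 k = + (2 ^ k)

pow2-suc : ∀ k → pow2 (suc k) ≡ + 2 *ᶻ pow2 k
pow2-suc k = ℤP.pos-* 2 (2 ^ k)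

D-σⁿ : ∀ k w → D (σⁿ k w) ≡ pow2 k *ᶻ D w
D-σⁿ zero    w = sym (ℤP.*-identityˡ (D w))
D-σⁿ (suc k) w = begin
  D (σⁿ k (σ w))                ≡⟨ D-σⁿ k (σ w) ⟩
  pow2 k *ᶻ D (σ w)             ≡⟨ cong (pow2 k *ᶻ_) (D-σ w) ⟩
  pow2 k *ᶻ (+ 2 *ᶻ D w)        ≡⟨ regroup (pow2 k) (D w) ⟩
  + 2 *ᶻ pow2 k *ᶻ D w          ≡⟨ cong (_*ᶻ D w) (pow2-suc k) ⟨
  pow2 (suc k) *ᶻ D w           ∎
  where
  open ≡-Reasoning
  regroup : ∀ u x → u *ᶻ (+ 2 *ᶻ x) ≡ + 2 *ᶻ u *ᶻ x
  regroup = ℤSolver.solve-∀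

three-count : ∀ w → + (3 * count false w) ≡ + length w +ᶻ D w
three-count []          = refl
three-count (false ∷ w) = begin
  + (3 * suc (count false w))              ≡⟨ cong +_ (ℕP.*-suc 3 (count false w)) ⟩
  + 3 +ᶻ + (3 * count false w)              ≡⟨ cong (+ 3 +ᶻ_) (three-count w) ⟩
  + 3 +ᶻ (+ length w +ᶻ D w)               ≡⟨ shuffle (+ length w) (D w) ⟩
  + suc (length w) +ᶻ (+ 2 +ᶻ D w)         ∎
  where
  open ≡-Reasoning
  shuffle : ∀ n e → + 3 +ᶻ (n +ᶻ e) ≡ (+ 1 +ᶻ n) +ᶻ (+ 2 +ᶻ e)
  shuffle = ℤSolver.solve-∀
three-count (true ∷ w) = trans (three-count w) (shuffle (+ length w) (D w))
  where
  shuffle : ∀ n e → n +ᶻ e ≡ (+ 1 +ᶻ n) +ᶻ (- + 1 +ᶻ e)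
  shuffle = ℤSolver.solve-∀

_∈[_,_] : ℤ → ℤ → ℤ → Set
h ∈[ lo , hi ] = lo ≤ᶻ h × h ≤ᶻ hi

Within : ℤ → ℤ → ℤ → Word → Set
Within lo hi h []      = h ∈[ lo , hi ]
Within lo hi h (x ∷ w) = h ∈[ lo , hi ] × Within lo hi (h +ᶻ d x) w

-- Within is decidable, which settles the finitely many concrete walks used below by computation.
within? : ∀ lo hi h w → Dec (Within lo hi h w)
within? lo hi h []      = (lo ≤ᶻ? h) ×-dec (h ≤ᶻ? hi)
within? lo hi h (x ∷ w) = ((lo ≤ᶻ? h) ×-dec (h ≤ᶻ? hi)) ×-dec within? lo hi (h +ᶻ d x) w

within-start : ∀ w {lo hi h} → Within lo hi h w → h ∈[ lo , hi ]
within-start []      h∈ = h∈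
within-start (x ∷ w) (h∈ , _) = h∈

within-≡ : ∀ w {lo lo′ hi hi′ h h′} → lo ≡ lo′ → hi ≡ hi′ → h ≡ h′ → Within lo hi h w → Within lo′ hi′ h′ w
within-≡ _ refl refl refl walk = walk

within-++ : ∀ u {v lo hi h} → Within lo hi h u → Within lo hi (h +ᶻ D u) v → Within lo hi h (u ++ v)
within-++ []      {v} {h = h} _ rest = within-≡ v refl refl (ℤP.+-identityʳ h) rest
within-++ (x ∷ u) {v} {h = h} (h∈ , walk) rest =
  h∈ , within-++ u {v} walk (within-≡ v refl refl (sym (ℤP.+-assoc h (d x) (D u))) rest)

within-prefix : ∀ u {v lo hi h} → Within lo hi h (u ++ v) → (h +ᶻ D u) ∈[ lo , hi ]
within-prefix []      {v} {h = h} walk = subst _∈[ _ , _ ] (sym (ℤP.+-identityʳ h)) (within-start v walk)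
within-prefix (x ∷ u) {h = h} (_ , walk) = subst _∈[ _ , _ ] (ℤP.+-assoc h (d x) (D u)) (within-prefix u walk)

within-widen : ∀ w {lo lo′ hi hi′ h} → lo′ ≤ᶻ lo → hi ≤ᶻ hi′ → Within lo hi h w → Within lo′ hi′ h w
within-widen []      lo′≤lo hi≤hi′ (lo≤h , h≤hi) = ℤP.≤-trans lo′≤lo lo≤h , ℤP.≤-trans h≤hi hi≤hi′
within-widen (x ∷ w) lo′≤lo hi≤hi′ ((lo≤h , h≤hi) , rest) =
  (ℤP.≤-trans lo′≤lo lo≤h , ℤP.≤-trans h≤hi hi≤hi′) , within-widen w lo′≤lo hi≤hi′ rest

within-translate : ∀ g w {lo hi h} → Within lo hi h w → Within (g +ᶻ lo) (g +ᶻ hi) (g +ᶻ h) w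
within-translate g []      (lo≤h , h≤hi) = ℤP.+-monoʳ-≤ g lo≤h , ℤP.+-monoʳ-≤ g h≤hi
within-translate g (x ∷ w) {h = h} ((lo≤h , h≤hi) , rest) =
  (ℤP.+-monoʳ-≤ g lo≤h , ℤP.+-monoʳ-≤ g h≤hi) ,
  within-≡ w refl refl (sym (ℤP.+-assoc g h (d x))) (within-translate g w rest)

double-mono : ∀ {i j} → i ≤ᶻ j → + 2 *ᶻ i ≤ᶻ + 2 *ᶻ j
double-mono = ℤP.*-monoˡ-≤-nonNeg (+ 2)

within-σ₁ : ∀ x {lo hi h} → h ∈[ lo , hi ] → (h +ᶻ d x) ∈[ lo , hi ] →
            Within (+ 2 *ᶻ lo) (+ 2 *ᶻ hi +ᶻ + 1) (+ 2 *ᶻ h) (σ₁ x)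
within-σ₁ false {lo} {hi} {h} (lo≤h , _) (_ , h+2≤hi) =
  within-widen (σ₁ false) (double-mono lo≤h) upper
    (within-≡ (σ₁ false) (ℤP.+-identityʳ (+ 2 *ᶻ h)) refl (ℤP.+-identityʳ (+ 2 *ᶻ h))
      (within-translate (+ 2 *ᶻ h) (σ₁ false) (from-yes (within? (+ 0) (+ 5) (+ 0) (σ₁ false)))))
  where
  shape : ∀ h → + 2 *ᶻ h +ᶻ + 5 ≡ + 2 *ᶻ (h +ᶻ + 2) +ᶻ + 1
  shape = ℤSolver.solve-∀
  upper : + 2 *ᶻ h +ᶻ + 5 ≤ᶻ + 2 *ᶻ hi +ᶻ + 1
  upper = subst (_≤ᶻ + 2 *ᶻ hi +ᶻ + 1) (sym (shape h)) (ℤP.+-monoˡ-≤ (+ 1) (double-mono h+2≤hi))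
within-σ₁ true {lo} {hi} {h} (_ , h≤hi) (lo≤h-1 , _) =
  within-widen (σ₁ true) lower upper
    (within-≡ (σ₁ true) refl (ℤP.+-identityʳ (+ 2 *ᶻ h)) (ℤP.+-identityʳ (+ 2 *ᶻ h))
      (within-translate (+ 2 *ᶻ h) (σ₁ true) (from-yes (within? (- + 2) (+ 0) (+ 0) (σ₁ true)))))
  where
  shape : ∀ h → + 2 *ᶻ (h +ᶻ - + 1) ≡ + 2 *ᶻ h +ᶻ - + 2
  shape = ℤSolver.solve-∀
  lower : + 2 *ᶻ lo ≤ᶻ + 2 *ᶻ h +ᶻ - + 2
  lower = subst (+ 2 *ᶻ lo ≤ᶻ_) (shape h) (double-mono lo≤h-1)
  upper : + 2 *ᶻ h ≤ᶻ + 2 *ᶻ hi +ᶻ + 1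
  upper = ℤP.≤-trans (double-mono h≤hi) (ℤP.i≤i+j (+ 2 *ᶻ hi) (+ 1))

within-σ : ∀ w {lo hi h} → Within lo hi h w → Within (+ 2 *ᶻ lo) (+ 2 *ᶻ hi +ᶻ + 1) (+ 2 *ᶻ h) (σ w)
within-σ []      {hi = hi} (lo≤h , h≤hi) = double-mono lo≤h , ℤP.≤-trans (double-mono h≤hi) (ℤP.i≤i+j (+ 2 *ᶻ hi) (+ 1))
within-σ (x ∷ w) {h = h} (h∈ , rest) =
  within-++ (σ₁ x) (within-σ₁ x h∈ (within-start w rest)) (within-≡ (σ w) refl refl next-start (within-σ w rest))
  where
  next-start : + 2 *ᶻ (h +ᶻ d x) ≡ + 2 *ᶻ h +ᶻ D (σ₁ x)
  next-start = trans (ℤP.*-distribˡ-+ (+ 2) h (d x)) (cong (+ 2 *ᶻ h +ᶻ_) (sym (D-σ₁ x)))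

within-σⁿ : ∀ k w {lo hi h} → Within lo hi h w →
            Within (pow2 k *ᶻ lo) (pow2 k *ᶻ hi +ᶻ pow2 k -ᶻ + 1) (pow2 k *ᶻ h) (σⁿ k w)
within-σⁿ zero    w {lo} {hi} {h} walk =
  within-≡ w (sym (ℤP.*-identityˡ lo)) (one hi) (sym (ℤP.*-identityˡ h)) walk
  where
  one : ∀ hi → hi ≡ + 1 *ᶻ hi +ᶻ + 1 -ᶻ + 1
  one = ℤSolver.solve-∀
within-σⁿ (suc k) w {lo} {hi} {h} walk =
  within-≡ (σⁿ k (σ w)) (scaled lo) (scaled-top hi) (scaled h) (within-σⁿ k (σ w) (within-σ w walk))
  where
  u = pow2 k
  scaled : ∀ x → u *ᶻ (+ 2 *ᶻ x) ≡ pow2 (suc k) *ᶻ x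
  scaled x = trans (regroup u x) (cong (_*ᶻ x) (sym (pow2-suc k)))
    where
    regroup : ∀ u x → u *ᶻ (+ 2 *ᶻ x) ≡ + 2 *ᶻ u *ᶻ x
    regroup = ℤSolver.solve-∀
  scaled-top : ∀ x → u *ᶻ (+ 2 *ᶻ x +ᶻ + 1) +ᶻ u -ᶻ + 1 ≡ pow2 (suc k) *ᶻ x +ᶻ pow2 (suc k) -ᶻ + 1
  scaled-top x = trans (regroup u x) (cong (λ v → v *ᶻ x +ᶻ v -ᶻ + 1) (sym (pow2-suc k)))
    where
    regroup : ∀ u x → u *ᶻ (+ 2 *ᶻ x +ᶻ + 1) +ᶻ u -ᶻ + 1 ≡ + 2 *ᶻ u *ᶻ x +ᶻ + 2 *ᶻ u -ᶻ + 1
    regroup = ℤSolver.solve-∀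

window-split : ∀ k j m → m ≤ 4 * 5 ^ k →
  ∃[ rest ] (slice (5 ^ k * j) (5 ^ k + m) ≡ σⁿ k (slice j 1) ++ slice (5 ^ k * suc j) m)
          × (slice (5 ^ k * suc j) m ++ rest ≡ σⁿ k (slice (suc j) 4))
window-split k j m m≤ = slice (m + 5 ^ k * suc j) (5 ^ k * 4 ∸ m) , head , tail
  where
  open ≡-Reasoning
  head : slice (5 ^ k * j) (5 ^ k + m) ≡ σⁿ k (slice j 1) ++ slice (5 ^ k * suc j) m
  head = begin
    slice (5 ^ k * j) (5 ^ k + m)                             ≡⟨ slice-++ (5 ^ k * j) (5 ^ k) m ⟩
    slice (5 ^ k * j) (5 ^ k) ++ slice (5 ^ k + 5 ^ k * j) m  ≡⟨ cong₂ _++_ first-block (cong (λ i → slice i m) (sym (ℕP.*-suc (5 ^ k) j))) ⟩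
    σⁿ k (slice j 1) ++ slice (5 ^ k * suc j) m               ∎
    where
    first-block : slice (5 ^ k * j) (5 ^ k) ≡ σⁿ k (slice j 1)
    first-block = trans (cong (slice (5 ^ k * j)) (sym (ℕP.*-identityʳ (5 ^ k)))) (slice-σⁿ k j 1)
  tail : slice (5 ^ k * suc j) m ++ slice (m + 5 ^ k * suc j) (5 ^ k * 4 ∸ m) ≡ σⁿ k (slice (suc j) 4)
  tail = begin
    slice (5 ^ k * suc j) m ++ slice (m + 5 ^ k * suc j) (5 ^ k * 4 ∸ m)  ≡⟨ slice-++ (5 ^ k * suc j) m _ ⟨
    slice (5 ^ k * suc j) (m + (5 ^ k * 4 ∸ m))                             ≡⟨ cong (slice (5 ^ k * suc j)) (ℕP.m+[n∸m]≡n m≤′) ⟩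
    slice (5 ^ k * suc j) (5 ^ k * 4)                                       ≡⟨ slice-σⁿ k (suc j) 4 ⟩
    σⁿ k (slice (suc j) 4)                                                  ∎
    where
    m≤′ : m ≤ 5 ^ k * 4
    m≤′ = subst (m ≤_) (ℕP.*-comm 4 (5 ^ k)) m≤

window-D : ∀ k j m {lo hi} → m ≤ 4 * 5 ^ k → Within lo hi (D (slice j 1)) (slice (suc j) 4) →
           D (slice (5 ^ k * j) (5 ^ k + m)) ∈[ pow2 k *ᶻ lo , pow2 k *ᶻ hi +ᶻ pow2 k -ᶻ + 1 ]
window-D k j m m≤ walk with window-split k j m m≤
... | rest , head , tail = subst _∈[ _ , _ ] (sym D-window) (within-prefix middle scaled-walk)
  where
  middle = slice (5 ^ k * suc j) m
  scaled-walk = subst (Within _ _ _) (sym tail) (within-σⁿ k (slice (suc j) 4) walk)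
  D-window : D (slice (5 ^ k * j) (5 ^ k + m)) ≡ pow2 k *ᶻ D (slice j 1) +ᶻ D middle
  D-window = trans (cong D head) (trans (D-++ (σⁿ k (slice j 1)) middle) (cong (_+ᶻ D middle) (D-σⁿ k (slice j 1))))

-- Φ[1..4] = 0101 stays in [2, 5] from height 2, so windows at 0 have D ≥ 2^(k+1).
near-window : ∀ k m → m ≤ 4 * 5 ^ k → 5 ^ k + m + 2 * 2 ^ k ≤ 3 * count false (slice 0 (5 ^ k + m))
near-window k m m≤ = ℤP.drop‿+≤+ (begin
  + (5 ^ k + m + 2 * 2 ^ k)              ≡⟨ ℤP.pos-+ (5 ^ k + m) (2 * 2 ^ k) ⟩
  + (5 ^ k + m) +ᶻ + (2 * 2 ^ k)         ≡⟨ cong (+ (5 ^ k + m) +ᶻ_) (trans (ℤP.pos-* 2 (2 ^ k)) (ℤP.*-comm (+ 2) (pow2 k))) ⟩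
  + (5 ^ k + m) +ᶻ pow2 k *ᶻ + 2         ≤⟨ ℤP.+-monoʳ-≤ (+ (5 ^ k + m)) (proj₁ bounds) ⟩
  + (5 ^ k + m) +ᶻ D window              ≡⟨ cong (λ n → + n +ᶻ D window) (length-slice 0 (5 ^ k + m)) ⟨
  + length window +ᶻ D window            ≡⟨ three-count window ⟨
  + (3 * count false window)             ∎)
  where
  open ℤP.≤-Reasoning
  window = slice 0 (5 ^ k + m)
  bounds : D window ∈[ pow2 k *ᶻ + 2 , pow2 k *ᶻ + 5 +ᶻ pow2 k -ᶻ + 1 ]
  bounds = subst (λ i → D (slice i (5 ^ k + m)) ∈[ pow2 k *ᶻ + 2 , pow2 k *ᶻ + 5 +ᶻ pow2 k -ᶻ + 1 ]) (ℕP.*-zeroʳ (5 ^ k))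
             (window-D k 0 m m≤ (from-yes (within? (+ 2) (+ 5) (D (slice 0 1)) (slice 1 4))))

-- Φ[49..52] = 1110 stays in [-4, -1] from height -1, so windows at 48·5^k have D ≤ -1.
far-window : ∀ k m → m ≤ 4 * 5 ^ k → 3 * count false (slice (5 ^ k * 48) (5 ^ k + m)) + 1 ≤ 5 ^ k + m
far-window k m m≤ = ℤP.drop‿+≤+ (begin
  + (3 * count false window + 1)           ≡⟨ ℤP.pos-+ (3 * count false window) 1 ⟩
  + (3 * count false window) +ᶻ + 1        ≡⟨ cong (_+ᶻ + 1) (three-count window) ⟩
  + length window +ᶻ D window +ᶻ + 1       ≡⟨ cong (λ n → + n +ᶻ D window +ᶻ + 1) (length-slice _ (5 ^ k + m)) ⟩
  + (5 ^ k + m) +ᶻ D window +ᶻ + 1         ≤⟨ ℤP.+-monoˡ-≤ (+ 1) (ℤP.+-monoʳ-≤ (+ (5 ^ k + m)) D≤-1) ⟩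
  + (5 ^ k + m) +ᶻ - + 1 +ᶻ + 1            ≡⟨ cancel (+ (5 ^ k + m)) ⟩
  + (5 ^ k + m)                            ∎)
  where
  open ℤP.≤-Reasoning
  window = slice (5 ^ k * 48) (5 ^ k + m)
  bounds : D window ∈[ pow2 k *ᶻ - + 4 , pow2 k *ᶻ - + 1 +ᶻ pow2 k -ᶻ + 1 ]
  bounds = window-D k 48 m m≤ (from-yes (within? (- + 4) (- + 1) (D (slice 48 1)) (slice 49 4)))
  top : ∀ u → u *ᶻ - + 1 +ᶻ u -ᶻ + 1 ≡ - + 1
  top = ℤSolver.solve-∀
  cancel : ∀ n → n +ᶻ - + 1 +ᶻ + 1 ≡ n
  cancel = ℤSolver.solve-∀
  D≤-1 : D window ≤ᶻ - + 1
  D≤-1 = subst (D window ≤ᶻ_) (top (pow2 k)) (proj₂ bounds)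

count-∷ : ∀ b x w → count b (x ∷ w) ≤ suc (count b w)
count-∷ false false w = ℕP.≤-refl
count-∷ false true  w = ℕP.n≤1+n _
count-∷ true  false w = ℕP.n≤1+n _
count-∷ true  true  w = ℕP.≤-refl

count-++ : ∀ b u v → count b u ≤ count b (u ++ v)
count-++ b     []          v = z≤n
count-++ false (false ∷ u) v = s≤s (count-++ false u v)
count-++ false (true ∷ u)  v = count-++ false u v
count-++ true  (false ∷ u) v = count-++ true u v
count-++ true  (true ∷ u)  v = s≤s (count-++ true u v)

count-sum : ∀ w → count false w + count true w ≡ length w
count-sum []          = refl
count-sum (false ∷ w) = cong suc (count-sum w)
count-sum (true ∷ w)  = trans (ℕP.+-suc (count false w) (count true w)) (cong suc (count-sum w))

sliding-count : ∀ n i → count false (slice i n) ≤ suc (count false (slice (suc i) n))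
sliding-count n i = begin
  count false (slice i n)                       ≤⟨ count-++ false (slice i n) (slice (n + i) 1) ⟩
  count false (slice i n ++ slice (n + i) 1)    ≡⟨ cong (count false) (slice-++ i n 1) ⟨
  count false (slice i (n + 1))                 ≡⟨ cong (λ l → count false (slice i l)) (ℕP.+-comm n 1) ⟩
  count false (Φ i ∷ slice (suc i) n)           ≤⟨ count-∷ false (Φ i) (slice (suc i) n) ⟩
  suc (count false (slice (suc i) n))           ∎
  where open ℕP.≤-Reasoning

ivt : (f : ℕ → ℕ) → (∀ i → f i ≤ suc (f (suc i))) → ∀ p j → f j ≤ p → p ≤ f 0 → ∃[ i ] f i ≡ p
ivt f step p zero    fj≤p p≤f0 = 0 , ℕP.≤-antisym fj≤p p≤f0
ivt f step p (suc j) fj≤p p≤f0 with f j ≤? p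
... | yes fj-1≤p = ivt f step p j fj-1≤p p≤f0
... | no  fj-1≰p = suc j , ℕP.≤-antisym fj≤p (s≤s⁻¹ (ℕP.≤-trans (ℕP.≰⇒> fj-1≰p) (step j)))

-- For 5^k ≤ n ≤ 5^(k+1), every p with 3p + 1 = n + e and e ≤ 2^(k+1) is the number of zeros of a
-- factor of Φ of length n: the near window has at least p zeros, the far window at most p.
zeros-in-window : ∀ k n p e → 5 ^ k ≤ n → n ≤ 5 * 5 ^ k → e ≤ 2 * 2 ^ k → 3 * p + 1 ≡ n + e →
                  ∃[ i ] count false (slice i n) ≡ p
zeros-in-window k n p e 5^k≤n n≤5^[k+1] e≤ balance =
  subst (λ n → ∃[ i ] count false (slice i n) ≡ p) n≡ (zeros-in-window′ (n ∸ 5 ^ k) m≤ (trans balance (cong (_+ e) (sym n≡))))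
  where
  n≡ : 5 ^ k + (n ∸ 5 ^ k) ≡ n
  n≡ = ℕP.m+[n∸m]≡n 5^k≤n
  m≤ : n ∸ 5 ^ k ≤ 4 * 5 ^ k
  m≤ = ℕP.+-cancelˡ-≤ (5 ^ k) _ _ (subst (_≤ 5 * 5 ^ k) (sym n≡) n≤5^[k+1])
  zeros-in-window′ : ∀ m → m ≤ 4 * 5 ^ k → 3 * p + 1 ≡ 5 ^ k + m + e → ∃[ i ] count false (slice i (5 ^ k + m)) ≡ p
  zeros-in-window′ m m≤ balance = ivt zeros (sliding-count (5 ^ k + m)) p (5 ^ k * 48) far≤p p≤near
    where
    zeros : ℕ → ℕ
    zeros i = count false (slice i (5 ^ k + m))
    open ℕP.≤-Reasoning
    p≤near : p ≤ zeros 0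
    p≤near = ℕP.*-cancelˡ-≤ 3 (begin
      3 * p                  ≤⟨ ℕP.m≤m+n (3 * p) 1 ⟩
      3 * p + 1              ≡⟨ balance ⟩
      5 ^ k + m + e          ≤⟨ ℕP.+-monoʳ-≤ (5 ^ k + m) e≤ ⟩
      5 ^ k + m + 2 * 2 ^ k  ≤⟨ near-window k m m≤ ⟩
      3 * zeros 0            ∎)
    far≤p : zeros (5 ^ k * 48) ≤ p
    far≤p = ℕP.*-cancelˡ-≤ 3 (ℕP.+-cancelʳ-≤ 1 _ _ (begin
      3 * zeros (5 ^ k * 48) + 1   ≤⟨ far-window k m m≤ ⟩
      5 ^ k + m                    ≤⟨ ℕP.m≤m+n (5 ^ k + m) e ⟩
      5 ^ k + m + e                ≡⟨ balance ⟨
      3 * p + 1                    ∎))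

+-∸-cancelᶻ : ∀ u v → u +ᶻ v -ᶻ v ≡ u
+-∸-cancelᶻ = ℤSolver.solve-∀

+-cancelʳ-≤ᶻ : ∀ i j k → i +ᶻ k ≤ᶻ j +ᶻ k → i ≤ᶻ j
+-cancelʳ-≤ᶻ i j k i+k≤j+k = subst₂ _≤ᶻ_ (+-∸-cancelᶻ i k) (+-∸-cancelᶻ j k) (ℤP.+-monoˡ-≤ (- k) i+k≤j+k)

ℕ→ℤ-identity : ∀ x a y b → 1 + x * a ≡ y * b → + 1 +ᶻ + x *ᶻ + a ≡ + y *ᶻ + b
ℕ→ℤ-identity x a y b eq = begin
  + 1 +ᶻ + x *ᶻ + a   ≡⟨ cong (+ 1 +ᶻ_) (ℤP.pos-* x a) ⟨
  + 1 +ᶻ + (x * a)    ≡⟨ ℤP.pos-+ 1 (x * a) ⟨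
  + (1 + x * a)       ≡⟨ cong +_ eq ⟩
  + (y * b)           ≡⟨ ℤP.pos-* y b ⟩
  + y *ᶻ + b          ∎
  where open ≡-Reasoning

signed-bezout : ∀ A B X Y → + 1 +ᶻ X *ᶻ A ≡ Y *ᶻ B → A *ᶻ (- X) +ᶻ B *ᶻ Y ≡ + 1
signed-bezout A B X Y e = begin
  A *ᶻ (- X) +ᶻ B *ᶻ Y          ≡⟨ rearrange A B X Y ⟩
  Y *ᶻ B -ᶻ X *ᶻ A              ≡⟨ cong (_-ᶻ X *ᶻ A) e ⟨
  + 1 +ᶻ X *ᶻ A -ᶻ X *ᶻ A       ≡⟨ +-∸-cancelᶻ (+ 1) (X *ᶻ A) ⟩
  + 1                           ∎
  where
  open ≡-Reasoning
  rearrange : ∀ A B X Y → A *ᶻ (- X) +ᶻ B *ᶻ Y ≡ Y *ᶻ B -ᶻ X *ᶻ A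
  rearrange = ℤSolver.solve-∀

bezout : ∀ {a b} → Coprime a b → ∃[ P ] ∃[ Q ] + a *ᶻ P +ᶻ + b *ᶻ Q ≡ + 1
bezout {a} {b} cop with coprime-Bézout cop
... | Bézout.+- x y eq = + x , - + y , trans (ℤP.+-comm (+ a *ᶻ + x) _) (signed-bezout (+ b) (+ a) (+ y) (+ x) (ℕ→ℤ-identity y b x a eq))
... | Bézout.-+ x y eq = - + x , + y , signed-bezout (+ a) (+ b) (+ x) (+ y) (ℕ→ℤ-identity x a y b eq)

pos-N : ∀ a b → + (a + 2 * b) ≡ + a +ᶻ + 2 *ᶻ + b
pos-N a b = trans (ℤP.pos-+ a (2 * b)) (cong (+ a +ᶻ_) (ℤP.pos-* 2 b))

-- Shifting a solution of ap + bq = M by (-b, a) lowers 2p - q by N = a + 2b, so some integer solution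
-- has 2p - q + 1 = e with 0 ≤ e < N.
balanced-solution : ∀ a b M → Coprime a b → .{{_ : NonZero (a + 2 * b)}} →
  ∃[ p ] ∃[ q ] ∃[ e ] (+ a *ᶻ p +ᶻ + b *ᶻ q ≡ + M × + 2 *ᶻ p -ᶻ q +ᶻ + 1 ≡ + e × e < a + 2 * b)
balanced-solution a b M cop with bezout cop
... | P , Q , aP+bQ≡1 = p , q , e , on-line , balanced , n%ℕd<d E N
  where
  open ≡-Reasoning
  N = a + 2 * b
  E = + 2 *ᶻ (+ M *ᶻ P) -ᶻ + M *ᶻ Q +ᶻ + 1
  s = E /ℕ N
  e = E %ℕ N
  p = + M *ᶻ P -ᶻ s *ᶻ + b
  q = + M *ᶻ Q +ᶻ s *ᶻ + a
  on-line : + a *ᶻ p +ᶻ + b *ᶻ q ≡ + M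
  on-line = begin
    + a *ᶻ p +ᶻ + b *ᶻ q               ≡⟨ expand (+ a) (+ b) (+ M) P Q s ⟩
    + M *ᶻ (+ a *ᶻ P +ᶻ + b *ᶻ Q)      ≡⟨ cong (+ M *ᶻ_) aP+bQ≡1 ⟩
    + M *ᶻ + 1                         ≡⟨ ℤP.*-identityʳ (+ M) ⟩
    + M                                ∎
    where
    expand : ∀ A B M P Q s → A *ᶻ (M *ᶻ P -ᶻ s *ᶻ B) +ᶻ B *ᶻ (M *ᶻ Q +ᶻ s *ᶻ A) ≡ M *ᶻ (A *ᶻ P +ᶻ B *ᶻ Q)
    expand = ℤSolver.solve-∀
  balanced : + 2 *ᶻ p -ᶻ q +ᶻ + 1 ≡ + e
  balanced = begin
    + 2 *ᶻ p -ᶻ q +ᶻ + 1               ≡⟨ expand (+ a) (+ b) (+ M) P Q s ⟩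
    E -ᶻ s *ᶻ (+ a +ᶻ + 2 *ᶻ + b)      ≡⟨ cong (λ t → E -ᶻ s *ᶻ t) (pos-N a b) ⟨
    E -ᶻ s *ᶻ + N                      ≡⟨ cong (_-ᶻ s *ᶻ + N) (a≡a%ℕn+[a/ℕn]*n E N) ⟩
    + e +ᶻ s *ᶻ + N -ᶻ s *ᶻ + N        ≡⟨ +-∸-cancelᶻ (+ e) (s *ᶻ + N) ⟩
    + e                                ∎
    where
    expand : ∀ A B M P Q s → + 2 *ᶻ (M *ᶻ P -ᶻ s *ᶻ B) -ᶻ (M *ᶻ Q +ᶻ s *ᶻ A) +ᶻ + 1
                           ≡ (+ 2 *ᶻ (M *ᶻ P) -ᶻ M *ᶻ Q +ᶻ + 1) -ᶻ s *ᶻ (A +ᶻ + 2 *ᶻ B)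
    expand = ℤSolver.solve-∀

skew-bound : ∀ a b e N → e < N → (+ a -ᶻ + b) *ᶻ (+ e -ᶻ + 1) ≤ᶻ + ∣ a - b ∣ *ᶻ + N
skew-bound a b e N e<N with ℕP.≤-total b a
... | inj₁ b≤a = begin
  (+ a -ᶻ + b) *ᶻ (+ e -ᶻ + 1)        ≡⟨ cong (_*ᶻ (+ e -ᶻ + 1)) a-b≡δ ⟩
  + ∣ a - b ∣ *ᶻ (+ e -ᶻ + 1)         ≤⟨ ℤP.*-monoˡ-≤-nonNeg (+ ∣ a - b ∣) (ℤP.i≤j⇒i-k≤j (+ 1) (+≤+ (ℕP.<⇒≤ e<N))) ⟩
  + ∣ a - b ∣ *ᶻ + N                  ∎
  where
  open ℤP.≤-Reasoning
  a-b≡δ : + a -ᶻ + b ≡ + ∣ a - b ∣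
  a-b≡δ = trans (ℤP.m-n≡m⊖n a b) (trans (ℤP.⊖-≥ b≤a) (cong +_ (sym (ℕP.m≤n⇒∣n-m∣≡n∸m b≤a))))
... | inj₂ a≤b = begin
  (+ a -ᶻ + b) *ᶻ (+ e -ᶻ + 1)        ≡⟨ cong (_*ᶻ (+ e -ᶻ + 1)) a-b≡-δ ⟩
  - + ∣ a - b ∣ *ᶻ (+ e -ᶻ + 1)       ≡⟨ flip (+ ∣ a - b ∣) (+ e) ⟩
  + ∣ a - b ∣ *ᶻ (+ 1 -ᶻ + e)         ≤⟨ ℤP.*-monoˡ-≤-nonNeg (+ ∣ a - b ∣) (ℤP.i≤j⇒i-k≤j (+ e) (+≤+ (ℕP.≤-trans (s≤s z≤n) e<N))) ⟩
  + ∣ a - b ∣ *ᶻ + N                  ∎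
  where
  open ℤP.≤-Reasoning
  a-b≡-δ : + a -ᶻ + b ≡ - + ∣ a - b ∣
  a-b≡-δ = trans (ℤP.m-n≡m⊖n a b) (trans (ℤP.⊖-swap a b)
             (cong -_ (trans (ℤP.⊖-≥ a≤b) (cong +_ (sym (ℕP.m≤n⇒∣m-n∣≡n∸m a≤b))))))
  flip : ∀ δ e → - δ *ᶻ (e -ᶻ + 1) ≡ δ *ᶻ (+ 1 -ᶻ e)
  flip = ℤSolver.solve-∀

-- A balanced solution is long: N(p+q) + (a-b)(2p-q) = 3M, so N(K + |a-b|) ≤ 3M forces p + q ≥ K.
long-solution : ∀ a b M {K} p q e → 0 < a + 2 * b →
  + a *ᶻ p +ᶻ + b *ᶻ q ≡ + M → + 2 *ᶻ p -ᶻ q +ᶻ + 1 ≡ + e → e < a + 2 * b →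
  (a + 2 * b) * (K + ∣ a - b ∣) ≤ 3 * M → + K ≤ᶻ p +ᶻ q
long-solution a b M {K} p q e N>0 on-line balanced e<N bound =
  ℤP.*-cancelˡ-≤-pos (+ K) (p +ᶻ q) (+ N) {{positive (+<+ N>0)}}
    (+-cancelʳ-≤ᶻ (+ N *ᶻ + K) (+ N *ᶻ (p +ᶻ q)) (+ δ *ᶻ + N) (begin
      + N *ᶻ + K +ᶻ + δ *ᶻ + N                  ≡⟨ lhs ⟩
      + (N * (K + δ))                           ≤⟨ +≤+ bound ⟩
      + (3 * M)                                 ≡⟨ three-M ⟨
      + N *ᶻ (p +ᶻ q) +ᶻ (+ a -ᶻ + b) *ᶻ (+ e -ᶻ + 1) ≤⟨ ℤP.+-monoʳ-≤ (+ N *ᶻ (p +ᶻ q)) (skew-bound a b e N e<N) ⟩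
      + N *ᶻ (p +ᶻ q) +ᶻ + δ *ᶻ + N             ∎))
  where
  open ℤP.≤-Reasoning
  N = a + 2 * b
  δ = ∣ a - b ∣
  lhs : + N *ᶻ + K +ᶻ + δ *ᶻ + N ≡ + (N * (K + δ))
  lhs = begin-equality
    + N *ᶻ + K +ᶻ + δ *ᶻ + N      ≡⟨ cong (+ N *ᶻ + K +ᶻ_) (ℤP.*-comm (+ δ) (+ N)) ⟩
    + N *ᶻ + K +ᶻ + N *ᶻ + δ      ≡⟨ ℤP.*-distribˡ-+ (+ N) (+ K) (+ δ) ⟨
    + N *ᶻ (+ K +ᶻ + δ)           ≡⟨ cong (+ N *ᶻ_) (ℤP.pos-+ K δ) ⟨
    + N *ᶻ + (K + δ)              ≡⟨ ℤP.pos-* N (K + δ) ⟨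
    + (N * (K + δ))               ∎
  three-M : + N *ᶻ (p +ᶻ q) +ᶻ (+ a -ᶻ + b) *ᶻ (+ e -ᶻ + 1) ≡ + (3 * M)
  three-M = begin-equality
    + N *ᶻ (p +ᶻ q) +ᶻ (+ a -ᶻ + b) *ᶻ (+ e -ᶻ + 1)
      ≡⟨ cong₂ (λ n t → n *ᶻ (p +ᶻ q) +ᶻ (+ a -ᶻ + b) *ᶻ t) (pos-N a b) (minus-one balanced) ⟩
    (+ a +ᶻ + 2 *ᶻ + b) *ᶻ (p +ᶻ q) +ᶻ (+ a -ᶻ + b) *ᶻ (+ 2 *ᶻ p -ᶻ q)
      ≡⟨ weights (+ a) (+ b) p q ⟩
    + 3 *ᶻ (+ a *ᶻ p +ᶻ + b *ᶻ q)
      ≡⟨ cong (+ 3 *ᶻ_) on-line ⟩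
    + 3 *ᶻ + M
      ≡⟨ ℤP.pos-* 3 M ⟨
    + (3 * M)   ∎
    where
    weights : ∀ A B p q → (A +ᶻ + 2 *ᶻ B) *ᶻ (p +ᶻ q) +ᶻ (A -ᶻ B) *ᶻ (+ 2 *ᶻ p -ᶻ q) ≡ + 3 *ᶻ (A *ᶻ p +ᶻ B *ᶻ q)
    weights = ℤSolver.solve-∀
    minus-one : ∀ {x} → x +ᶻ + 1 ≡ + e → + e -ᶻ + 1 ≡ x
    minus-one {x} x+1≡e = trans (cong (_-ᶻ + 1) (sym x+1≡e)) (+-∸-cancelᶻ x (+ 1))

log5 : ∀ n → 0 < n → ∃[ k ] (5 ^ k ≤ n × n < 5 ^ suc k)
log5 (suc zero)    _ = 0 , ℕP.≤-refl , s≤s (s≤s z≤n)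
log5 (suc (suc n)) _ with log5 (suc n) z<s
... | k , lower , upper with suc (suc n) <? 5 ^ suc k
...   | yes n+2<5^[k+1] = k , ℕP.≤-trans lower (ℕP.n≤1+n _) , n+2<5^[k+1]
...   | no  n+2≮5^[k+1] = suc k , ℕP.≤-reflexive (sym n+2≡5^[k+1]) , subst (_< 5 * 5 ^ suc k) (sym n+2≡5^[k+1]) grows
  where
  n+2≡5^[k+1] : suc (suc n) ≡ 5 ^ suc k
  n+2≡5^[k+1] = ℕP.≤-antisym upper (ℕP.≮⇒≥ n+2≮5^[k+1])
  grows : 5 ^ suc k < 5 * 5 ^ suc k
  grows = ℕP.m<m+n (5 ^ suc k) (ℕP.*-monoʳ-< 4 (ℕP.m^n>0 5 (suc k)))

-- If 132·5^j ≤ n < 5^(k+1) then k ≥ j + 3, because 5^(j+3) = 125·5^j < 132·5^j.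
exponent-gap : ∀ j k n → 132 * 5 ^ j ≤ n → n < 5 ^ suc k → 3 + j ≤ k
exponent-gap j k n K≤n n<5^[k+1] with suc k ≤? 3 + j
... | no  k+1≰j+3 = s≤s⁻¹ (ℕP.≰⇒> k+1≰j+3)
... | yes k+1≤j+3 = ⊥-elim (ℕP.<-irrefl refl (ℕP.<-≤-trans n<5^[k+1] (begin
  5 ^ suc k              ≤⟨ ℕP.^-monoʳ-≤ 5 k+1≤j+3 ⟩
  5 ^ (3 + j)            ≤⟨ ℕP.m≤m+n (5 ^ (3 + j)) (7 * 5 ^ j) ⟩
  5 ^ (3 + j) + 7 * 5 ^ j ≡⟨ split (5 ^ j) ⟩
  132 * 5 ^ j            ≤⟨ K≤n ⟩
  n                      ∎)))
  where
  open ℕP.≤-Reasoning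
  split : ∀ x → 5 * (5 * (5 * x)) + 7 * x ≡ 132 * x
  split = solve-∀

ceiling-bound : ∀ a b → a + 2 * b + 3 ≤ 3 * Cab a b
ceiling-bound a b = begin
  a + 2 * b + 3                    ≡⟨ ℕP.+-comm (a + 2 * b) 3 ⟩
  3 + (a + 2 * b)                  ≡⟨ ℕP.+-assoc 3 a (2 * b) ⟨
  3 + a + 2 * b                    ≤⟨ ℕP.≤-trans (ℕP.m≤m⊔n (3 + a + 2 * b) (3 * b)) (ℕP.≤-trans (ℕP.m≤m⊔n _ (b ∸ a)) (ℕP.m≤m⊔n _ 12)) ⟩
  X                                ≤⟨ ℕP.+-cancelʳ-≤ 2 X _ X+2≤ ⟩
  (X + 2) / 3 * 3                  ≡⟨ ℕP.*-comm ((X + 2) / 3) 3 ⟩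
  3 * Cab a b                      ∎
  where
  open ℕP.≤-Reasoning
  X = (3 + a + 2 * b) ⊔ (3 * b) ⊔ (b ∸ a) ⊔ 12
  X+2≤ : X + 2 ≤ (X + 2) / 3 * 3 + 2
  X+2≤ = begin
    X + 2                              ≡⟨ m≡m%n+[m/n]*n (X + 2) 3 ⟩
    (X + 2) % 3 + (X + 2) / 3 * 3      ≤⟨ ℕP.+-monoˡ-≤ ((X + 2) / 3 * 3) (s≤s⁻¹ (m%n<n (X + 2) 3)) ⟩
    2 + (X + 2) / 3 * 3                ≡⟨ ℕP.+-comm 2 _ ⟩
    (X + 2) / 3 * 3 + 2                ∎

linear≤exp : ∀ j → 3 * j + 9 ≤ 16 * 2 ^ j
linear≤exp zero    = ℕP.≤-trans (ℕP.n≤1+n 9) (ℕP.m≤m+n 10 6)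
linear≤exp (suc j) = begin
  3 * suc j + 9             ≡⟨ step j ⟩
  (3 * j + 9) + 3           ≤⟨ ℕP.+-mono-≤ (linear≤exp j) (ℕP.≤-trans (ℕP.m≤m+n 3 13) (ℕP.*-monoʳ-≤ 16 (ℕP.m^n>0 2 j))) ⟩
  16 * 2 ^ j + 16 * 2 ^ j   ≡⟨ double (2 ^ j) ⟩
  16 * 2 ^ suc j            ∎
  where
  open ℕP.≤-Reasoning
  step : ∀ j → 3 * suc j + 9 ≡ 3 * j + 9 + 3
  step = solve-∀
  double : ∀ x → 16 * x + 16 * x ≡ 16 * (2 * x)
  double = solve-∀

base-small : ∀ a b → a + 2 * b ≤ 16 * 2 ^ (Cab a b ∸ 4)
base-small a b = ℕP.≤-trans (ℕP.+-cancelʳ-≤ 3 _ _ (begin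
  a + 2 * b + 3                  ≤⟨ ceiling-bound a b ⟩
  3 * Cab a b                    ≤⟨ ℕP.*-monoʳ-≤ 3 (ℕP.m≤n+m∸n (Cab a b) 4) ⟩
  3 * (4 + (Cab a b ∸ 4))        ≡⟨ shift (Cab a b ∸ 4) ⟩
  3 * (Cab a b ∸ 4) + 9 + 3      ∎)) (linear≤exp (Cab a b ∸ 4))
  where
  open ℕP.≤-Reasoning
  shift : ∀ j → 3 * (4 + j) ≡ 3 * j + 9 + 3
  shift = solve-∀

natural-third : ∀ p n → 0 < n → + 3 *ᶻ p +ᶻ + 1 ≡ + n → ∃[ p′ ] (p ≡ + p′ × 3 * p′ + 1 ≡ n)
natural-third p n n>0 eq = ∣ p ∣ , sym p≡ , ℤP.+-injective (begin
  + (3 * ∣ p ∣ + 1)           ≡⟨ trans (ℤP.pos-+ (3 * ∣ p ∣) 1) (cong (_+ᶻ + 1) (ℤP.pos-* 3 ∣ p ∣)) ⟩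
  + 3 *ᶻ + ∣ p ∣ +ᶻ + 1       ≡⟨ cong (λ t → + 3 *ᶻ t +ᶻ + 1) p≡ ⟩
  + 3 *ᶻ p +ᶻ + 1             ≡⟨ eq ⟩
  + n                         ∎)
  where
  open ≡-Reasoning
  0≤3p : + 3 *ᶻ + 0 ≤ᶻ + 3 *ᶻ p
  0≤3p = +-cancelʳ-≤ᶻ (+ 0) (+ 3 *ᶻ p) (+ 1) (subst (+ 1 ≤ᶻ_) (sym eq) (+≤+ n>0))
  p≡ : + ∣ p ∣ ≡ p
  p≡ = ℤP.0≤i⇒+∣i∣≡i (ℤP.*-cancelˡ-≤-pos (+ 0) p (+ 3) 0≤3p)

zeros-in-long-window : ∀ j n e p → 132 * 5 ^ j ≤ n → e ≤ 16 * 2 ^ j → + 3 *ᶻ p +ᶻ + 1 ≡ + (n + e) →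
                       ∃[ i ] p ≡ + count false (slice i n)
zeros-in-long-window j n e p K≤n e≤ three-p
  with natural-third p (n + e) (ℕP.≤-trans n>0 (ℕP.m≤m+n n e)) three-p | log5 n n>0
  where
  n>0 : 0 < n
  n>0 = ℕP.<-≤-trans z<s (ℕP.≤-trans (ℕP.*-monoʳ-≤ 132 (ℕP.m^n>0 5 j)) K≤n)
... | p′ , p≡ , balance | k , 5^k≤n , n<5^[k+1] =
  map₂ (λ zeros≡ → trans p≡ (cong +_ (sym zeros≡)))
       (zeros-in-window k n p′ e 5^k≤n (ℕP.<⇒≤ n<5^[k+1]) e≤2·2^k balance)
  where
  e≤2·2^k : e ≤ 2 * 2 ^ k
  e≤2·2^k = ℕP.≤-trans e≤ (ℕP.≤-trans (ℕP.≤-reflexive (regroup (2 ^ j)))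
              (ℕP.*-monoʳ-≤ 2 (ℕP.^-monoʳ-≤ 2 (exponent-gap j k n K≤n n<5^[k+1]))))
    where
    regroup : ∀ x → 16 * x ≡ 2 * (2 * (2 * (2 * x)))
    regroup = solve-∀

weights-positive : ∀ a {b} → 0 < b → 0 < a + 2 * b
weights-positive a {b} b>0 = ℕP.<-≤-trans b>0 (ℕP.≤-trans (ℕP.m≤m+n b (b + 0)) (ℕP.m≤n+m (2 * b) a))

natural-length : ∀ {K z} → + K ≤ᶻ z → ∃[ n ] (+ n ≡ z × K ≤ n)
natural-length {K} {z} K≤z = ∣ z ∣ , z≡ , ℤP.drop‿+≤+ (subst (+ K ≤ᶻ_) (sym z≡) K≤z)
  where
  z≡ : + ∣ z ∣ ≡ z
  z≡ = ℤP.0≤i⇒+∣i∣≡i (ℤP.≤-trans (+≤+ z≤n) K≤z)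

three-thirds : ∀ p q {e n} → + 2 *ᶻ p -ᶻ q +ᶻ + 1 ≡ + e → + n ≡ p +ᶻ q → + 3 *ᶻ p +ᶻ + 1 ≡ + (n + e)
three-thirds p q {e} {n} balanced n≡ = begin
  + 3 *ᶻ p +ᶻ + 1                   ≡⟨ split p q ⟩
  (p +ᶻ q) +ᶻ (+ 2 *ᶻ p -ᶻ q +ᶻ + 1) ≡⟨ cong₂ _+ᶻ_ (sym n≡) balanced ⟩
  + n +ᶻ + e                         ≡⟨ ℤP.pos-+ n e ⟨
  + (n + e)                          ∎
  where
  open ≡-Reasoning
  split : ∀ p q → + 3 *ᶻ p +ᶻ + 1 ≡ (p +ᶻ q) +ᶻ (+ 2 *ᶻ p -ᶻ q +ᶻ + 1)
  split = ℤSolver.solve-∀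

weight-from-counts : ∀ a b M p q u → + a *ᶻ p +ᶻ + b *ᶻ q ≡ + M → p ≡ + count false u → p +ᶻ q ≡ + length u →
                     M ≡ a * count false u + b * count true u
weight-from-counts a b M p q u on-line p≡ length≡ = ℤP.+-injective (begin
  + M                                          ≡⟨ on-line ⟨
  + a *ᶻ p +ᶻ + b *ᶻ q                          ≡⟨ cong₂ (λ x y → + a *ᶻ x +ᶻ + b *ᶻ y) p≡ q≡ ⟩
  + a *ᶻ + count false u +ᶻ + b *ᶻ + count true u ≡⟨ cong₂ _+ᶻ_ (ℤP.pos-* a _) (ℤP.pos-* b _) ⟨
  + (a * count false u) +ᶻ + (b * count true u) ≡⟨ ℤP.pos-+ (a * count false u) _ ⟨
  + (a * count false u + b * count true u)     ∎)
  where
  open ≡-Reasoning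
  q≡ : q ≡ + count true u
  q≡ = begin
    q                                         ≡⟨ take-away p q ⟩
    (p +ᶻ q) -ᶻ p                             ≡⟨ cong₂ _-ᶻ_ (trans length≡ (cong +_ (sym (count-sum u)))) p≡ ⟩
    + (count false u + count true u) -ᶻ + count false u ≡⟨ cong (_-ᶻ + count false u) (ℤP.pos-+ (count false u) _) ⟩
    + count false u +ᶻ + count true u -ᶻ + count false u ≡⟨ take-away (+ count false u) (+ count true u) ⟨
    + count true u                            ∎
    where
    take-away : ∀ x y → y ≡ (x +ᶻ y) -ᶻ x
    take-away = ℤSolver.solve-∀

weight-of-factor : ∀ a b M → 0 < b → Coprime a b → B3 a b ≤ 3 * M →
                   ∃[ u ] (InL u × M ≡ a * count false u + b * count true u)
weight-of-factor a b M b>0 cop long =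
  case balanced-solution a b M cop {{ℕ.>-nonZero N>0}} of λ where
    (p , q , e , on-line , balanced , e<N) →
      case natural-length (long-solution a b M p q e N>0 on-line balanced e<N long) of λ where
        (n , n≡ , K≤n) →
          case zeros-in-long-window (Cab a b ∸ 4) n e p K≤n (below-N e<N) (three-thirds p q balanced n≡) of λ where
            (i , p≡) → slice i n , (i , cong (slice i) (sym (length-slice i n))) ,
                       weight-from-counts a b M p q (slice i n) on-line p≡ (trans (sym n≡) (cong +_ (sym (length-slice i n))))
  where
  N>0 : 0 < a + 2 * b
  N>0 = weights-positive a b>0
  below-N : ∀ {e} → e < a + 2 * b → e ≤ 16 * 2 ^ (Cab a b ∸ 4)
  below-N e<N = ℕP.<⇒≤ (ℕP.<-≤-trans e<N (base-small a b))

representation : ∀ a b M u → InL u → M ≡ a * count false u + b * count true u →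
                 ∃[ x ] ∃[ y ] (M ≡ a * x + b * y ×
                   ∃[ t ] ∃[ p ] ∃[ q ]
                     ((+ x -ᶻ t *ᶻ + b ≡ + p) × (+ y +ᶻ t *ᶻ + a ≡ + q) ×
                      (+ M ≡ + a *ᶻ + p +ᶻ + b *ᶻ + q) × InψL (p , q)))
representation a b M u factor M≡ =
  x , y , M≡ , + 0 , x , y , ℤP.+-identityʳ (+ x) , ℤP.+-identityʳ (+ y) , M≡ᶻ , (u , factor , refl)
  where
  x = count false u
  y = count true u
  M≡ᶻ : + M ≡ + a *ᶻ + x +ᶻ + b *ᶻ + y
  M≡ᶻ = trans (cong +_ M≡) (trans (ℤP.pos-+ (a * x) (b * y)) (cong₂ _+ᶻ_ (ℤP.pos-* a x) (ℤP.pos-* b y)))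

-- Lemma 8.
lemma8 : (a b : ℕ) → 0 < a → 0 < b → Coprime a b →
         (M : ℕ) → (a + 2 * b) * (a ⊔ b) ≤ M → B3 a b ≤ 3 * M →
         ∃[ x ] ∃[ y ] (M ≡ a * x + b * y ×
           ∃[ t ] ∃[ p ] ∃[ q ]
             ((+ x -ᶻ t *ᶻ + b ≡ + p) × (+ y +ᶻ t *ᶻ + a ≡ + q) ×
              (+ M ≡ + a *ᶻ + p +ᶻ + b *ᶻ + q) × InψL (p , q)))
lemma8 a b _ b>0 cop M _ long = case weight-of-factor a b M b>0 cop long of λ where
  (u , factor , M≡) → representation a b M u factor M≡
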